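{- Suppose $r\geq3$ is an integer and $A,B,C\subseteq[r]$ satisfy $|A|=|B|=|C|=m(r)$ and there is no violating triple $(a,b,c)\in A\times B\times C$. Then one of the following holds: (1) $r$ is even and $A=B=C=[m(r)-1,r]$; (2) $r$ is odd and for some relabeling $\{A,B,C\}=\{D,E,F\}$ one of the following holds: (a) $D=E=F=[m(r)-1,r-1]$; (b) $D=F=[m(r),r]$ and $E\subseteq[m(r)-1,r]$.
   Context: $[r]=\{1,\ldots,r\}$, $[i,j]=\{i,\ldots,j\}$, $m(r)=\lceil\frac{r+1}2\rceil$. A violating triple is a tuple $(i,j,k)\in\mathbb N^3$ for which $|i-j|\leq k\leq i+j$ fails. -}

module Defs where

open import Data.Nat using (ℕ; zero; suc; _+_; _∸_; _≤_; _≤ᵇ_; ⌈_/2⌉; ∣_-_∣)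
open import Data.Nat.Divisibility using (_∣_)
open import Data.Bool using (_∧_)
open import Data.Fin using (Fin; toℕ)
import Data.Fin
open import Data.Fin.Subset using (Subset; _∈_; _∉_; _⊆_; ∣_∣)
open import Data.Vec using (tabulate)
open import Data.Product using (_×_; Σ-syntax)
open import Data.Sum using (_⊎_)
open import Relation.Nullary using (¬_)
open import Relation.Binary.PropositionalEquality using (_≡_)

m : ℕ → ℕ
m r = ⌈ suc r /2⌉

Violating : ℕ → ℕ → ℕ → Set
Violating i j k = ¬ ((∣ i - j ∣ ≤ k) × (k ≤ i + j))

-- A subset of [r] = {1,…,r} is represented as a Subset (suc r) of
-- Fin (suc r) (element x ↔ natural number toℕ x) not containing 0.
InRange : (r : ℕ) → Subset (suc r) → Set
InRange r A = Data.Fin.zero ∉ A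

interval : (r : ℕ) → ℕ → ℕ → Subset (suc r)
interval r i j = tabulate (λ x → (i ≤ᵇ toℕ x) ∧ (toℕ x ≤ᵇ j))

Relabeling : {n : ℕ} → (A B C D E F : Subset n) → Set
Relabeling A B C D E F =
    (D ≡ A × E ≡ B × F ≡ C) ⊎ (D ≡ A × E ≡ C × F ≡ B)
  ⊎ (D ≡ B × E ≡ A × F ≡ C) ⊎ (D ≡ B × E ≡ C × F ≡ A)
  ⊎ (D ≡ C × E ≡ A × F ≡ B) ⊎ (D ≡ C × E ≡ B × F ≡ A)

NoViolating : {n : ℕ} → (A B C : Subset n) → Set
NoViolating {n} A B C = (a b c : Fin n) → a ∈ A → b ∈ B → c ∈ C →
  ¬ Violating (toℕ a) (toℕ b) (toℕ c)

-- Write r = 2k or 2k + 1; then each of A, B, C has k + 1 elements, so it contains x ≤ y with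
-- x + k ≤ y. Having no violating triple means that any a ∈ A, b ∈ B, c ∈ C satisfy the three
-- triangle inequalities. Applying them to an arbitrary a ∈ A and to the extreme elements of B and C
-- gives k ≤ a, so all three sets lie in [k, r]. For even r this interval has exactly k + 1 elements.
-- For odd r, if two of the sets have an element ≤ k, then every element of the third is ≤ 2k, so the
-- third set is [k, 2k], hence has an element ≤ k, and the same argument puts the other two sets in
-- [k, 2k]. Otherwise two of the sets lie in [k + 1, r], which has exactly k + 1 elements.
module Submission where

open import Defs
open import Data.Bool using (_∧_)
open import Data.Bool.Properties using (T-≡; T-∧)
open import Data.Fin using (Fin; toℕ; zero; suc)
open import Data.Fin.Properties using (toℕ<n; any?)
open import Data.Fin.Subset using (Subset; _∈_; _⊆_; ∣_∣; inside; outside; Nonempty)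
open import Data.Fin.Subset.Properties using (drop-∷-⊆; nonempty?; p⊆q⇒∣p∣≤∣q∣; _∈?_)
open import Data.Nat using (ℕ; zero; suc; _+_; _*_; _∸_; _≤_; _<_; z≤n; s≤s; s≤s⁻¹; ∣_-_∣; _≤?_; _≤ᵇ_)
open import Data.Nat.Properties
open import Data.Nat.Divisibility using (_∣_; divides)
open import Data.Product using (_×_; _,_; proj₁; proj₂; ∃-syntax; Σ-syntax)
open import Data.Sum using (_⊎_; inj₁; inj₂)
open import Data.Vec using ([]; _∷_; lookup)
open import Data.Vec.Base using (here; there)
open import Data.Vec.Properties using (lookup∘tabulate; []=⇒lookup; lookup⇒[]=)
open import Function.Bundles using (Equivalence)
open import Relation.Nullary using (¬_; yes; no; contradiction)
open import Relation.Nullary.Decidable using (decidable-stable; _×-dec_)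
open import Relation.Binary.PropositionalEquality

private
  variable
    n r k lo hi : ℕ

Within : ℕ → ℕ → Subset n → Set
Within lo hi p = ∀ {x} → x ∈ p → lo ≤ toℕ x × toℕ x < hi

Within-tail : ∀ {s} {p : Subset n} → Within lo hi (s ∷ p) → Within (lo ∸ 1) (hi ∸ 1) p
Within-tail w x∈p = let lo≤x , x<hi = w (there x∈p) in ∸-monoˡ-≤ 1 lo≤x , ∸-monoˡ-≤ 1 x<hi

∣p∣≤hi∸lo : (p : Subset n) → Within lo hi p → ∣ p ∣ ≤ hi ∸ lo
∣p∣≤hi∸lo [] _ = z≤n
∣p∣≤hi∸lo {lo = lo} {hi} (outside ∷ p) w = ≤-trans (∣p∣≤hi∸lo p (Within-tail w)) (pred∸pred lo)
  where
  pred∸pred : ∀ lo → hi ∸ 1 ∸ (lo ∸ 1) ≤ hi ∸ lo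
  pred∸pred zero = m∸n≤m hi 1
  pred∸pred (suc lo) = ≤-reflexive (∸-+-assoc hi 1 lo)
∣p∣≤hi∸lo (inside ∷ p) w with w here
∣p∣≤hi∸lo {lo = zero} {suc hi} (inside ∷ p) w | _ = s≤s (∣p∣≤hi∸lo p (Within-tail w))

⊆∧∣⊇∣⇒≡ : {p q : Subset n} → p ⊆ q → ∣ q ∣ ≤ ∣ p ∣ → p ≡ q
⊆∧∣⊇∣⇒≡ {p = []} {[]} _ _ = refl
⊆∧∣⊇∣⇒≡ {p = outside ∷ p} {outside ∷ q} p⊆q ∣q∣≤∣p∣ =
  cong (outside ∷_) (⊆∧∣⊇∣⇒≡ (drop-∷-⊆ p⊆q) ∣q∣≤∣p∣)
⊆∧∣⊇∣⇒≡ {p = inside ∷ p} {inside ∷ q} p⊆q ∣q∣≤∣p∣ =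
  cong (inside ∷_) (⊆∧∣⊇∣⇒≡ (drop-∷-⊆ p⊆q) (s≤s⁻¹ ∣q∣≤∣p∣))
⊆∧∣⊇∣⇒≡ {p = inside ∷ p} {outside ∷ q} p⊆q _ with p⊆q here
... | ()
⊆∧∣⊇∣⇒≡ {p = outside ∷ p} {inside ∷ q} p⊆q ∣q∣<∣p∣ =
  contradiction (≤-trans ∣q∣<∣p∣ (p⊆q⇒∣p∣≤∣q∣ (drop-∷-⊆ p⊆q))) (n≮n ∣ q ∣)

0<∣p∣⇒Nonempty : {p : Subset n} → 0 < ∣ p ∣ → Nonempty p
0<∣p∣⇒Nonempty {p = inside ∷ p} _ = zero , here
0<∣p∣⇒Nonempty {p = outside ∷ p} 0<∣p∣ = let x , x∈p = 0<∣p∣⇒Nonempty 0<∣p∣ in suc x , there x∈p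

least : (p : Subset n) → Nonempty p → ∃[ x ] x ∈ p × (∀ {y} → y ∈ p → toℕ x ≤ toℕ y)
least (inside ∷ p) _ = zero , here , λ _ → z≤n
least (outside ∷ p) (suc x , there x∈p) with least p (x , x∈p)
... | l , l∈p , l≤ = suc l , there l∈p , λ { (there y∈p) → s≤s (l≤ y∈p) }

greatest : (p : Subset n) → Nonempty p → ∃[ x ] x ∈ p × (∀ {y} → y ∈ p → toℕ y ≤ toℕ x)
greatest (s ∷ p) _ with nonempty? p
greatest (s ∷ p) _ | yes ne with greatest p ne
... | g , g∈p , ≤g = suc g , there g∈p , λ { here → z≤n ; (there y∈p) → s≤s (≤g y∈p) }
greatest (s ∷ p) (zero , 0∈) | no empty = zero , 0∈ , λ { here → z≤n ; (there y∈p) → contradiction (_ , y∈p) empty }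
greatest (s ∷ p) (suc x , there x∈p) | no empty = contradiction (x , x∈p) empty

spread : {S : Subset n} → ∣ S ∣ ≡ suc k → ∃[ x ] ∃[ y ] x ∈ S × y ∈ S × toℕ x + k ≤ toℕ y
spread {k = k} {S} ∣S∣ with least S nonempty | greatest S nonempty
  where nonempty = 0<∣p∣⇒Nonempty (≤-trans (s≤s z≤n) (≤-reflexive (sym ∣S∣)))
... | x , x∈S , x≤ | y , y∈S , ≤y = x , y , x∈S , y∈S , x+k≤y
  where
  1+k≤1+y∸x : suc k ≤ suc (toℕ y) ∸ toℕ x
  1+k≤1+y∸x = ≤-trans (≤-reflexive (sym ∣S∣)) (∣p∣≤hi∸lo S λ z∈S → x≤ z∈S , s≤s (≤y z∈S))
  x+k≤y : toℕ x + k ≤ toℕ y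
  x+k≤y = ≤-trans (≤-reflexive (+-comm (toℕ x) k))
    (s≤s⁻¹ (m≤o∸n⇒m+n≤o (suc k) (≤-trans (x≤ y∈S) (n≤1+n _)) 1+k≤1+y∸x))

module _ {i j : ℕ} {x : Fin (suc r)} where

  lookup-interval : lookup (interval r i j) x ≡ (i ≤ᵇ toℕ x) ∧ (toℕ x ≤ᵇ j)
  lookup-interval = lookup∘tabulate (λ y → (i ≤ᵇ toℕ y) ∧ (toℕ y ≤ᵇ j)) x

  ∈-interval⁻ : x ∈ interval r i j → i ≤ toℕ x × toℕ x ≤ j
  ∈-interval⁻ x∈ =
    let i≤ᵇx , x≤ᵇj = Equivalence.to T-∧ (Equivalence.from T-≡ (trans (sym lookup-interval) ([]=⇒lookup x∈)))
    in ≤ᵇ⇒≤ i (toℕ x) i≤ᵇx , ≤ᵇ⇒≤ (toℕ x) j x≤ᵇj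

  ∈-interval⁺ : i ≤ toℕ x → toℕ x ≤ j → x ∈ interval r i j
  ∈-interval⁺ i≤x x≤j = lookup⇒[]= x (interval r i j)
    (trans lookup-interval (Equivalence.to T-≡ (Equivalence.from T-∧ (≤⇒≤ᵇ i≤x , ≤⇒≤ᵇ x≤j))))

interval-Within : ∀ i j → Within i (suc j) (interval r i j)
interval-Within i j x∈ = let i≤x , x≤j = ∈-interval⁻ x∈ in i≤x , s≤s x≤j

Within⇒⊆interval : ∀ {i j} {S : Subset (suc r)} → Within i (suc j) S → S ⊆ interval r i j
Within⇒⊆interval w x∈S = let i≤x , x<1+j = w x∈S in ∈-interval⁺ i≤x (s≤s⁻¹ x<1+j)

Within⇒≡interval : ∀ {i j} {S : Subset (suc r)} → Within i (suc j) S → ∣ S ∣ ≡ suc k → j ≤ i + k →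
                   S ≡ interval r i j
Within⇒≡interval {r} {k} {i} {j} {S} w ∣S∣ j≤i+k = ⊆∧∣⊇∣⇒≡ (Within⇒⊆interval w) (begin
  ∣ interval r i j ∣ ≤⟨ ∣p∣≤hi∸lo (interval r i j) (interval-Within i j) ⟩
  suc j ∸ i         ≤⟨ m≤n+o⇒m∸n≤o (suc j) i (≤-trans (s≤s j≤i+k) (≤-reflexive (sym (+-suc i k)))) ⟩
  suc k             ≡⟨ sym ∣S∣ ⟩
  ∣ S ∣             ∎)
  where open ≤-Reasoning

≡final-segment : ∀ {i} {S : Subset (suc r)} → ∣ S ∣ ≡ suc k → r ≤ i + k →
                 (∀ {x} → x ∈ S → i ≤ toℕ x) → S ≡ interval r i r
≡final-segment ∣S∣ r≤i+k i≤ = Within⇒≡interval (λ x∈S → i≤ x∈S , toℕ<n _) ∣S∣ r≤i+k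

⊆final-segment : ∀ {i} {S : Subset (suc r)} → (∀ {x} → x ∈ S → i ≤ toℕ x) → S ⊆ interval r i r
⊆final-segment i≤ x∈S = ∈-interval⁺ (i≤ x∈S) (s≤s⁻¹ (toℕ<n _))

Triangle : ℕ → ℕ → ℕ → Set
Triangle a b c = a ≤ b + c × b ≤ c + a × c ≤ a + b

¬Violating⇒Triangle : ∀ a b c → ¬ Violating a b c → Triangle a b c
¬Violating⇒Triangle a b c ¬v = m≤n+o a b ∣a-b∣≤c , b≤c+a , c≤a+b
  where
  ∣a-b∣≤c×c≤a+b : ∣ a - b ∣ ≤ c × c ≤ a + b
  ∣a-b∣≤c×c≤a+b = decidable-stable ((∣ a - b ∣ ≤? c) ×-dec (c ≤? a + b)) ¬v
  ∣a-b∣≤c = proj₁ ∣a-b∣≤c×c≤a+b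
  c≤a+b = proj₂ ∣a-b∣≤c×c≤a+b
  m≤n+o : ∀ m n {o} → ∣ m - n ∣ ≤ o → m ≤ n + o
  m≤n+o m n ∣m-n∣≤o = ≤-trans (m≤n+m∸n m n) (+-monoʳ-≤ n (≤-trans (m∸n≤∣m-n∣ m n) ∣m-n∣≤o))
  b≤c+a : b ≤ c + a
  b≤c+a = ≤-trans (m≤n+o b a (subst (_≤ c) (∣-∣-comm a b) ∣a-b∣≤c)) (≤-reflexive (+-comm a c))

Triangular : Subset n → Subset n → Subset n → Set
Triangular A B C = ∀ {a b c} → a ∈ A → b ∈ B → c ∈ C → Triangle (toℕ a) (toℕ b) (toℕ c)

NoViolating⇒Triangular : {A B C : Subset n} → NoViolating A B C → Triangular A B C
NoViolating⇒Triangular nv {a} {b} {c} a∈A b∈B c∈C = ¬Violating⇒Triangle _ _ _ (nv a b c a∈A b∈B c∈C)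

rotate : {A B C : Subset n} → Triangular A B C → Triangular B C A
rotate tri b∈B c∈C a∈A = let a≤b+c , b≤c+a , c≤a+b = tri a∈A b∈B c∈C in b≤c+a , c≤a+b , a≤b+c

k≤x : ∀ {k x y z} → y + k ≤ z + x → z + k ≤ x + y → k ≤ x
k≤x {k} {x} {y} {z} y+k≤z+x z+k≤x+y with k ≤? x
... | yes k≤x = k≤x
... | no k≰x = contradiction y<z (<⇒≯ z<y)
  where
  x<k : x < k
  x<k = ≰⇒> k≰x
  y<z : y < z
  y<z = +-cancelʳ-< k y z (≤-<-trans y+k≤z+x (+-monoʳ-< z x<k))
  z<y : z < y
  z<y = +-cancelʳ-< k z y (≤-<-trans z+k≤x+y (≤-<-trans (≤-reflexive (+-comm x y)) (+-monoʳ-< y x<k)))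

Triangular⇒k≤ : {A B C : Subset n} → Triangular A B C → ∣ B ∣ ≡ suc k → ∣ C ∣ ≡ suc k →
                ∀ {a} → a ∈ A → k ≤ toℕ a
Triangular⇒k≤ tri ∣B∣ ∣C∣ a∈A with spread ∣B∣ | spread ∣C∣
... | b₀ , b₁ , b₀∈B , b₁∈B , b₀+k≤b₁ | c₀ , c₁ , c₀∈C , c₁∈C , c₀+k≤c₁ =
  k≤x (≤-trans b₀+k≤b₁ (proj₁ (proj₂ (tri a∈A b₁∈B c₀∈C))))
      (≤-trans c₀+k≤c₁ (proj₂ (proj₂ (tri a∈A b₀∈B c₁∈C))))

Low : ℕ → Subset n → Set
Low k S = ∃[ x ] x ∈ S × toℕ x ≤ k

low? : ∀ k (S : Subset n) → Low k S ⊎ (∀ {x} → x ∈ S → k < toℕ x)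
low? k S with any? (λ x → x ∈? S ×-dec toℕ x ≤? k)
... | yes low = inj₁ low
... | no ¬low = inj₂ λ {x} x∈S → ≰⇒> λ x≤k → ¬low (x , x∈S , x≤k)

Triangular⇒≤k+k : {A B C : Subset n} → Triangular A B C → Low k A → Low k B →
                  ∀ {c} → c ∈ C → toℕ c ≤ k + k
Triangular⇒≤k+k tri (_ , a∈A , a≤k) (_ , b∈B , b≤k) c∈C =
  ≤-trans (proj₂ (proj₂ (tri a∈A b∈B c∈C))) (+-mono-≤ a≤k b≤k)

≤k+k⇒Low : {C : Subset n} → ∣ C ∣ ≡ suc k → (∀ {c} → c ∈ C → toℕ c ≤ k + k) → Low k C
≤k+k⇒Low {k = k} ∣C∣ ≤k+k with spread ∣C∣
... | c₀ , c₁ , c₀∈C , c₁∈C , c₀+k≤c₁ = c₀ , c₀∈C , +-cancelʳ-≤ k _ k (≤-trans c₀+k≤c₁ (≤k+k c₁∈C))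

module _ {A B C : Subset (suc r)} (∣A∣ : ∣ A ∣ ≡ suc k) (∣B∣ : ∣ B ∣ ≡ suc k) (∣C∣ : ∣ C ∣ ≡ suc k)
         (tri : Triangular A B C) where

  k≤A : ∀ {a} → a ∈ A → k ≤ toℕ a
  k≤A = Triangular⇒k≤ tri ∣B∣ ∣C∣

  k≤B : ∀ {b} → b ∈ B → k ≤ toℕ b
  k≤B = Triangular⇒k≤ (rotate tri) ∣C∣ ∣A∣

  k≤C : ∀ {c} → c ∈ C → k ≤ toℕ c
  k≤C = Triangular⇒k≤ (rotate (rotate tri)) ∣A∣ ∣B∣

  Low²⇒≡middle : Low k A → Low k B →
                 A ≡ interval r k (k + k) × B ≡ interval r k (k + k) × C ≡ interval r k (k + k)
  Low²⇒≡middle lowA lowB = ≡middle ∣A∣ k≤A A≤ , ≡middle ∣B∣ k≤B B≤ , ≡middle ∣C∣ k≤C C≤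
    where
    ≡middle : ∀ {S} → ∣ S ∣ ≡ suc k → (∀ {x} → x ∈ S → k ≤ toℕ x) → (∀ {x} → x ∈ S → toℕ x ≤ k + k) →
              S ≡ interval r k (k + k)
    ≡middle ∣S∣ k≤ ≤k+k = Within⇒≡interval (λ x∈S → k≤ x∈S , s≤s (≤k+k x∈S)) ∣S∣ ≤-refl
    C≤ : ∀ {c} → c ∈ C → toℕ c ≤ k + k
    C≤ = Triangular⇒≤k+k tri lowA lowB
    lowC : Low k C
    lowC = ≤k+k⇒Low ∣C∣ C≤
    A≤ : ∀ {a} → a ∈ A → toℕ a ≤ k + k
    A≤ = Triangular⇒≤k+k (rotate tri) lowB lowC
    B≤ : ∀ {b} → b ∈ B → toℕ b ≤ k + k
    B≤ = Triangular⇒≤k+k (rotate (rotate tri)) lowC lowA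

module _ {A B C : Subset (suc (k + k))} (∣A∣ : ∣ A ∣ ≡ suc k) (∣B∣ : ∣ B ∣ ≡ suc k) (∣C∣ : ∣ C ∣ ≡ suc k)
         (tri : Triangular A B C) where

  even-case : A ≡ interval (k + k) k (k + k) × B ≡ interval (k + k) k (k + k) × C ≡ interval (k + k) k (k + k)
  even-case = ≡final-segment ∣A∣ ≤-refl (k≤A ∣A∣ ∣B∣ ∣C∣ tri)
            , ≡final-segment ∣B∣ ≤-refl (k≤B ∣A∣ ∣B∣ ∣C∣ tri)
            , ≡final-segment ∣C∣ ≤-refl (k≤C ∣A∣ ∣B∣ ∣C∣ tri)

module _ {A B C : Subset (suc (suc (k + k)))} (∣A∣ : ∣ A ∣ ≡ suc k) (∣B∣ : ∣ B ∣ ≡ suc k) (∣C∣ : ∣ C ∣ ≡ suc k)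
         (tri : Triangular A B C) where

  private
    Middle = interval (suc (k + k)) k (k + k)
    Upper = interval (suc (k + k)) (suc k) (suc (k + k))

    ≡Upper : ∀ {S} → ∣ S ∣ ≡ suc k → (∀ {x} → x ∈ S → k < toℕ x) → S ≡ Upper
    ≡Upper ∣S∣ = ≡final-segment ∣S∣ ≤-refl

  odd-case : Σ[ D ∈ Subset _ ] Σ[ E ∈ Subset _ ] Σ[ F ∈ Subset _ ] (Relabeling A B C D E F ×
               ((D ≡ Middle × E ≡ Middle × F ≡ Middle)
               ⊎ (D ≡ Upper × F ≡ Upper × E ⊆ interval (suc (k + k)) k (suc (k + k)))))
  odd-case with low? k A | low? k B | low? k C
  ... | inj₁ lowA | inj₁ lowB | _ =
    A , B , C , inj₁ (refl , refl , refl) , inj₁ (Low²⇒≡middle ∣A∣ ∣B∣ ∣C∣ tri lowA lowB)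
  ... | inj₁ lowA | inj₂ _ | inj₁ lowC =
    let C≡ , A≡ , B≡ = Low²⇒≡middle ∣C∣ ∣A∣ ∣B∣ (rotate (rotate tri)) lowC lowA
    in A , B , C , inj₁ (refl , refl , refl) , inj₁ (A≡ , B≡ , C≡)
  ... | inj₂ _ | inj₁ lowB | inj₁ lowC =
    let B≡ , C≡ , A≡ = Low²⇒≡middle ∣B∣ ∣C∣ ∣A∣ (rotate tri) lowB lowC
    in A , B , C , inj₁ (refl , refl , refl) , inj₁ (A≡ , B≡ , C≡)
  ... | inj₁ _ | inj₂ highB | inj₂ highC =
    B , A , C , inj₂ (inj₂ (inj₁ (refl , refl , refl))) ,
    inj₂ (≡Upper ∣B∣ highB , ≡Upper ∣C∣ highC , ⊆final-segment (k≤A ∣A∣ ∣B∣ ∣C∣ tri))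
  ... | inj₂ highA | inj₁ _ | inj₂ highC =
    A , B , C , inj₁ (refl , refl , refl) ,
    inj₂ (≡Upper ∣A∣ highA , ≡Upper ∣C∣ highC , ⊆final-segment (k≤B ∣A∣ ∣B∣ ∣C∣ tri))
  ... | inj₂ highA | inj₂ highB | _ =
    A , C , B , inj₂ (inj₁ (refl , refl , refl)) ,
    inj₂ (≡Upper ∣A∣ highA , ≡Upper ∣B∣ highB , ⊆final-segment (k≤C ∣A∣ ∣B∣ ∣C∣ tri))

even⊎odd : ∀ r → ∃[ k ] (r ≡ k + k ⊎ r ≡ suc (k + k))
even⊎odd zero = 0 , inj₁ refl
even⊎odd (suc r) with even⊎odd r
... | k , inj₁ refl = k , inj₂ refl
... | k , inj₂ refl = suc k , inj₁ (cong suc (sym (+-suc k k)))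

2∣k+k : ∀ k → 2 ∣ k + k
2∣k+k k = divides k (trans (cong (k +_) (sym (+-identityʳ k))) (*-comm 2 k))

¬2∣1+k+k : ∀ k → ¬ 2 ∣ suc (k + k)
¬2∣1+k+k k (divides q 1+k+k≡q*2) = even≢odd q k (begin
  2 * q        ≡⟨ *-comm 2 q ⟩
  q * 2        ≡⟨ sym 1+k+k≡q*2 ⟩
  suc (k + k)  ≡⟨ cong (λ j → suc (k + j)) (sym (+-identityʳ k)) ⟩
  suc (2 * k)  ∎)
  where open ≡-Reasoning

-- Since m r unfolds to suc ⌊ r /2⌋, the rewrites
-- turn m r into suc k.
lemma4p14 : (r : ℕ) → 3 ≤ r → (A B C : Subset (suc r)) →
    InRange r A → InRange r B → InRange r C →
    ∣ A ∣ ≡ m r → ∣ B ∣ ≡ m r → ∣ C ∣ ≡ m r →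
    NoViolating A B C →
    (2 ∣ r × A ≡ interval r (m r ∸ 1) r × B ≡ interval r (m r ∸ 1) r × C ≡ interval r (m r ∸ 1) r)
    ⊎ (¬ (2 ∣ r) × Σ[ D ∈ Subset (suc r) ] Σ[ E ∈ Subset (suc r) ] Σ[ F ∈ Subset (suc r) ]
        (Relabeling A B C D E F ×
          ((D ≡ interval r (m r ∸ 1) (r ∸ 1) × E ≡ interval r (m r ∸ 1) (r ∸ 1) × F ≡ interval r (m r ∸ 1) (r ∸ 1))
          ⊎ (D ≡ interval r (m r) r × F ≡ interval r (m r) r × E ⊆ interval r (m r ∸ 1) r))))
lemma4p14 r _ A B C _ _ _ ∣A∣ ∣B∣ ∣C∣ nv with even⊎odd r
... | k , inj₁ refl rewrite sym (n≡⌊n+n/2⌋ k) =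
  inj₁ (2∣k+k k , even-case ∣A∣ ∣B∣ ∣C∣ (NoViolating⇒Triangular nv))
... | k , inj₂ refl rewrite sym (n≡⌈n+n/2⌉ k) =
  inj₂ (¬2∣1+k+k k , odd-case ∣A∣ ∣B∣ ∣C∣ (NoViolating⇒Triangular nv))
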